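{- Let $\mathbf P=(P,\le,0,1)$ be a complemented poset of finite length and assume $\odot$ to be weakly monotone from the right. Then $\mathbf P$ is uniquely complemented.
   Context: $(P,\le,0,1)$ is a bounded poset with $0\ne1$, complemented (every element has a complement $b$ with $a\vee b=1$, $a\wedge b=0$), of finite length (no infinite chains). $x^+$ denotes the set of all complements of $x$. $\mathrm{Max}\,A$ is the set of maximal elements of $A$; $L(A)$, $U(A)$ are the sets of lower, upper bounds, with $L(A,B):=L(A\cup B)$ etc. Define $a\odot b:=\mathrm{Max}\,L\big(b,U(a,b^+)\big)$. For sets, $A\le B$ means $x\le y$ for all $x\in A$, $y\in B$ (singletons identified with elements). $\odot$ is weakly monotone from the right if $x\odot y\le x\odot1$ for all $x,y\in P$. -}

module Defs where

open import Level using (Level; _⊔_)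
open import Data.Nat using (ℕ)
open import Data.Product using (_×_; Σ; ∃)
open import Data.Sum using (_⊎_)
open import Relation.Nullary using (¬_)
open import Relation.Unary using (Pred; _∈_)
open import Relation.Binary.PropositionalEquality using (_≡_)
open import Relation.Binary.Structures using (IsPartialOrder)
open import Function.Definitions using (Injective)

record BoundedPoset (a ℓ : Level) : Set (Level.suc (a ⊔ ℓ)) where
  field
    Carrier        : Set a
    _≤_            : Carrier → Carrier → Set ℓ
    isPartialOrder : IsPartialOrder _≡_ _≤_
    𝟎 𝟏            : Carrier
    𝟎-least        : ∀ x → 𝟎 ≤ x
    𝟏-greatest     : ∀ x → x ≤ 𝟏
    𝟎≢𝟏            : ¬ (𝟎 ≡ 𝟏)

module _ {a ℓ : Level} (𝐏 : BoundedPoset a ℓ) where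
  open BoundedPoset 𝐏

  PSet : Set (Level.suc (a ⊔ ℓ))
  PSet = Pred Carrier (a ⊔ ℓ)

  U : PSet → PSet
  U A x = ∀ y → y ∈ A → y ≤ x

  L : PSet → PSet
  L A x = ∀ y → y ∈ A → x ≤ y

  _∪_ : PSet → PSet → PSet
  (A ∪ B) x = A x ⊎ B x

  ⟦_⟧ : Carrier → PSet
  ⟦ c ⟧ x = Level.Lift (a ⊔ ℓ) (x ≡ c)

  Max : PSet → PSet
  Max A m = (m ∈ A) × (∀ z → z ∈ A → m ≤ z → z ≡ m)

  -- b is a complement of a:  a ∨ b = 1 and a ∧ b = 0 (as suprema/infima in P),
  -- i.e. 1 is the only common upper bound and 0 the only common lower bound.
  IsComplement : Carrier → Carrier → Set (a ⊔ ℓ)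
  IsComplement x y = (∀ z → x ≤ z → y ≤ z → z ≡ 𝟏) × (∀ z → z ≤ x → z ≤ y → z ≡ 𝟎)

  _⁺ : Carrier → PSet
  (x ⁺) y = Level.Lift (a ⊔ ℓ) (IsComplement x y)

  _⊙_ : Carrier → Carrier → PSet
  x ⊙ y = Max (L (⟦ y ⟧ ∪ U (⟦ x ⟧ ∪ (y ⁺))))

  _≤ₛ_ : PSet → PSet → Set (a ⊔ ℓ)
  A ≤ₛ B = ∀ x y → x ∈ A → y ∈ B → x ≤ y

  Complemented : Set (a ⊔ ℓ)
  Complemented = ∀ x → ∃ λ y → IsComplement x y

  UniquelyComplemented : Set (a ⊔ ℓ)
  UniquelyComplemented = ∀ x y z → IsComplement x y → IsComplement x z → y ≡ z

  -- finite length: there is no infinite chain, i.e. no injective sequence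
  -- ℕ → P whose image is pairwise comparable
  IsInfiniteChain : (ℕ → Carrier) → Set (a ⊔ ℓ)
  IsInfiniteChain f = Injective _≡_ _≡_ f × (∀ i j → f i ≤ f j ⊎ f j ≤ f i)

  FiniteLength : Set (a ⊔ ℓ)
  FiniteLength = ¬ (Σ (ℕ → Carrier) IsInfiniteChain)

  WeaklyMonotoneRight : Set (a ⊔ ℓ)
  WeaklyMonotoneRight = ∀ x y → (x ⊙ y) ≤ₛ (x ⊙ 𝟏)

-- Let b and c be complements of x. Since x is also a complement of c, the only
-- common upper bound of b and c⁺ is 1, so c is the greatest element of
-- L(c, U(b, c⁺)), i.e. c ∈ b ⊙ c. Since 1⁺ = {0}, U(b, 1⁺) is the principal
-- filter of b, so b ∈ b ⊙ 1. Weak monotonicity from the right gives c ≤ b, and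
-- by symmetry b = c.
module Submission where

open import Defs using (BoundedPoset; Complemented; FiniteLength; WeaklyMonotoneRight; UniquelyComplemented)
import Defs as D
open import Level using (Level; lift)
open import Data.Product using (_,_)
open import Data.Sum using (inj₁; inj₂)
open import Relation.Unary using (_∈_)
open import Relation.Binary.PropositionalEquality using (refl; sym; subst)
open import Relation.Binary.Structures using (IsPartialOrder)

module _ {a ℓ : Level} (𝐏 : BoundedPoset a ℓ) where
  open BoundedPoset 𝐏
  open IsPartialOrder isPartialOrder using (antisym; reflexive)

  private
    IsComplement = D.IsComplement 𝐏
    L            = D.L 𝐏
    U            = D.U 𝐏
    _∪_          = D._∪_ 𝐏
    ⟦_⟧          = D.⟦_⟧ 𝐏
    _⁺           = D._⁺ 𝐏
    Max          = D.Max 𝐏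
    _⊙_          = D._⊙_ 𝐏

  ≤-refl : ∀ x → x ≤ x
  ≤-refl x = reflexive refl

  IsComplement-sym : ∀ {x y} → IsComplement x y → IsComplement y x
  IsComplement-sym (join , meet) = (λ z y≤z x≤z → join z x≤z y≤z)
                                 , (λ z z≤y z≤x → meet z z≤x z≤y)

  greatest∈Max : ∀ {A m} → m ∈ A → (∀ z → z ∈ A → z ≤ m) → m ∈ Max A
  greatest∈Max m∈A greatest = m∈A , λ z z∈A m≤z → antisym (greatest z z∈A) m≤z

  complement∈⊙ : ∀ {x b c} → IsComplement x b → IsComplement x c → c ∈ b ⊙ c
  complement∈⊙ {x} {b} {c} (join , _) x⁺c =
    greatest∈Max c∈L (λ z z∈L → z∈L c (inj₁ (lift refl)))
    where
    c∈L : c ∈ L (⟦ c ⟧ ∪ U (⟦ b ⟧ ∪ (c ⁺)))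
    c∈L y (inj₁ (lift refl)) = ≤-refl c
    c∈L y (inj₂ y∈U) = subst (c ≤_) (sym (join y x≤y b≤y)) (𝟏-greatest c)
      where
      x≤y : x ≤ y
      x≤y = y∈U x (inj₂ (lift (IsComplement-sym x⁺c)))
      b≤y : b ≤ y
      b≤y = y∈U b (inj₁ (lift refl))

  self∈⊙𝟏 : ∀ b → b ∈ b ⊙ 𝟏
  self∈⊙𝟏 b = greatest∈Max b∈L (λ z z∈L → z∈L b (inj₂ b∈U))
    where
    b∈U : b ∈ U (⟦ b ⟧ ∪ (𝟏 ⁺))
    b∈U w (inj₁ (lift refl)) = ≤-refl b
    b∈U w (inj₂ (lift (_ , meet))) =
      subst (_≤ b) (sym (meet w (𝟏-greatest w) (≤-refl w))) (𝟎-least b)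
    b∈L : b ∈ L (⟦ 𝟏 ⟧ ∪ U (⟦ b ⟧ ∪ (𝟏 ⁺)))
    b∈L y (inj₁ (lift refl)) = 𝟏-greatest b
    b∈L y (inj₂ y∈U) = y∈U b (inj₁ (lift refl))

  complement-≤ : WeaklyMonotoneRight 𝐏 →
                 ∀ {x b c} → IsComplement x b → IsComplement x c → c ≤ b
  complement-≤ monotone {b = b} {c} x⁺b x⁺c =
    monotone b c c b (complement∈⊙ x⁺b x⁺c) (self∈⊙𝟏 b)

lemma4p4 : {a ℓ : Level} (𝐏 : BoundedPoset a ℓ) →
    Complemented 𝐏 → FiniteLength 𝐏 → WeaklyMonotoneRight 𝐏 →
    UniquelyComplemented 𝐏
lemma4p4 𝐏 _ _ monotone x y z x⁺y x⁺z =
  antisym (complement-≤ 𝐏 monotone x⁺z x⁺y) (complement-≤ 𝐏 monotone x⁺y x⁺z)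
  where open IsPartialOrder (BoundedPoset.isPartialOrder 𝐏) using (antisym)
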